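{- Let $b=r_1^{t_1}r_2^{t_2}\cdots r_\ell^{t_\ell}$ with $r_1<r_2<\cdots<r_\ell$ primes and $t_i\ge1$, and let $x$ be an integer coprime with $b$. If $\mathrm{ord}_{r_i^{t_i}}(x)=r_i^{h_i}$ with $0\le h_i\le t_i-1$ for all $i=1,\dots,\ell$, then $b\mid\Psi_b(x)$.
   Context: $\Psi_b(x)=\frac{x^b-1}{x-1}=x^{b-1}+\cdots+x+1$; $\mathrm{ord}_n(x)$ is the least positive integer $s$ with $x^s\equiv1\pmod n$. -}

module Defs where

open import Data.Nat as ℕ using (ℕ; zero; suc)
open import Data.Fin using (Fin)
import Data.Fin as Fin
open import Data.Integer as ℤ using (ℤ)
open import Data.Integer.Divisibility using (_∣_)
open import Data.Product using (_×_)
open import Relation.Nullary using (¬_)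

-- Ψ_b(x) = x^(b-1) + ... + x + 1  (= (x^b - 1)/(x - 1)), as an integer
Ψ : ℕ → ℤ → ℤ
Ψ zero    x = ℤ.0ℤ
Ψ (suc b) x = x ℤ.^ b ℤ.+ Ψ b x

∏ : (ℓ : ℕ) → (Fin ℓ → ℕ) → ℕ
∏ zero    f = 1
∏ (suc ℓ) f = f Fin.zero ℕ.* ∏ ℓ (λ i → f (Fin.suc i))

IsOrd : ℕ → ℤ → ℕ → Set
IsOrd n x s =
  (0 ℕ.< s) ×
  (ℤ.+ n ∣ (x ℤ.^ s ℤ.- ℤ.1ℤ)) ×
  (∀ s′ → 0 ℕ.< s′ → s′ ℕ.< s → ¬ (ℤ.+ n ∣ (x ℤ.^ s′ ℤ.- ℤ.1ℤ)))

{-# OPTIONS --safe #-}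
module Submission where

-- Fix a prime power p^t dividing b, and suppose x^(p^h) ≡ 1 (mod p^t) with h ≤ t.
-- Writing b = k m with m = p^h and p^(t-h) ∣ k, the identity Ψ_(k m)(x) = Ψ_m(x) Ψ_k(x^m)
-- splits Ψ_b(x) into two factors. The second is ≡ k (mod p^(t-h)) because
-- Ψ_k(y) ≡ k whenever y ≡ 1, so p^(t-h) divides it. The first is divisible by
-- p^h: if p ∣ x - 1 this follows by induction on h from the same two facts, and
-- otherwise p^h is coprime to x - 1 and divides (x - 1) Ψ_(p^h)(x) = x^(p^h) - 1.
-- Hence p^t ∣ Ψ_b(x), and the prime powers of b are pairwise coprime.

module CoprimeFactors where
  open import Defs using (∏)
  open import Data.Nat using (zero; suc; _*_; _^_; s≤s; z≤n)
  open import Data.Nat.Properties using (*-comm)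
  open import Data.Nat.Divisibility
  open import Data.Nat.Coprimality
  open import Data.Nat.Primality using (Prime; prime⇒irreducible)
  import Data.Fin as Fin
  open import Data.Product using (_,_)
  open import Data.Sum using (inj₁; inj₂)
  open import Relation.Nullary using (contradiction)
  open import Relation.Binary.PropositionalEquality using (refl; subst)

  prime∤⇒coprime : ∀ {p n} → Prime p → p ∤ n → Coprime p n
  prime∤⇒coprime p-prime p∤n (d∣p , d∣n) with prime⇒irreducible p-prime d∣p
  ... | inj₁ d≡1  = d≡1
  ... | inj₂ refl = contradiction d∣n p∤n

  coprime-*ʳ : ∀ {a m n} → Coprime a m → Coprime a n → Coprime a (m * n)
  coprime-*ʳ {a} {m} {n} a⊥m a⊥n {d} (d∣a , d∣mn) = a⊥n (d∣a , coprime-divisor d⊥m d∣mn)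
    where
    d⊥m : Coprime d m
    d⊥m (e∣d , e∣m) = a⊥m (∣-trans e∣d d∣a , e∣m)

  coprime-^ʳ : ∀ {a n} t → Coprime a n → Coprime a (n ^ t)
  coprime-^ʳ {a} zero    _   = sym (1-coprimeTo a)
  coprime-^ʳ     (suc t) a⊥n = coprime-*ʳ a⊥n (coprime-^ʳ t a⊥n)

  coprime-^ˡ : ∀ {m a} s → Coprime m a → Coprime (m ^ s) a
  coprime-^ˡ s m⊥a = sym (coprime-^ʳ s (sym m⊥a))

  coprime-^ : ∀ {m n} s t → Coprime m n → Coprime (m ^ s) (n ^ t)
  coprime-^ s t m⊥n = coprime-^ˡ s (coprime-^ʳ t m⊥n)

  coprime-∏ : ∀ {a} ℓ f → (∀ i → Coprime a (f i)) → Coprime a (∏ ℓ f)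
  coprime-∏ {a} zero    f _      = sym (1-coprimeTo a)
  coprime-∏     (suc ℓ) f a⊥f[_] =
    coprime-*ʳ a⊥f[ Fin.zero ] (coprime-∏ ℓ (λ i → f (Fin.suc i)) (λ i → a⊥f[ Fin.suc i ]))

  coprime⇒*∣ : ∀ {m n o} → Coprime m n → m ∣ o → n ∣ o → m * n ∣ o
  coprime⇒*∣ {m} {n} {o} m⊥n m∣o n∣o =
    coprime-factors m⊥n (*-monoʳ-∣ m n∣o , subst (m * n ∣_) (*-comm o n) (*-monoˡ-∣ n m∣o))

  ∣∏ : ∀ ℓ f i → f i ∣ ∏ ℓ f
  ∣∏ (suc ℓ) f Fin.zero    = ∣m⇒∣m*n (∏ ℓ (λ j → f (Fin.suc j))) ∣-refl
  ∣∏ (suc ℓ) f (Fin.suc i) = ∣n⇒∣m*n (f Fin.zero) (∣∏ ℓ (λ j → f (Fin.suc j)) i)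

  pairwiseCoprime∧∣⇒∏∣ : ∀ {o} ℓ f → (∀ i j → i Fin.< j → Coprime (f i) (f j)) →
                         (∀ i → f i ∣ o) → ∏ ℓ f ∣ o
  pairwiseCoprime∧∣⇒∏∣ {o} zero    f _ _   = 1∣ o
  pairwiseCoprime∧∣⇒∏∣     (suc ℓ) f coprime f∣o =
    coprime⇒*∣ (coprime-∏ ℓ _ (λ j → coprime Fin.zero (Fin.suc j) (s≤s z≤n)))
               (f∣o Fin.zero)
               (pairwiseCoprime∧∣⇒∏∣ ℓ (λ j → f (Fin.suc j))
                  (λ i j i<j → coprime (Fin.suc i) (Fin.suc j) (s≤s i<j))
                  (λ j → f∣o (Fin.suc j)))

module Repunit where
  open import Defs
  open import Data.Nat as ℕ using (ℕ; zero; suc)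
  import Data.Nat.Properties as ℕ
  import Data.Nat.Divisibility as ℕ
  open import Data.Nat.Primality using (Prime)
  open import Data.Integer using (+_; _+_; _*_; _-_; _^_; 1ℤ; 0ℤ)
  open import Data.Integer.Properties
  open import Data.Integer.Divisibility.Signed
  import Data.Integer.Coprimality as ℤ
  open import Data.Integer.Tactic.RingSolver using (solve-∀)
  open import Relation.Nullary using (yes; no)
  open import Relation.Binary.PropositionalEquality
  open CoprimeFactors
  open ≡-Reasoning

  Ψ-+ : ∀ m n x → Ψ (m ℕ.+ n) x ≡ x ^ n * Ψ m x + Ψ n x
  Ψ-+ zero    n x = sym (trans (cong (_+ Ψ n x) (*-zeroʳ (x ^ n))) (+-identityˡ (Ψ n x)))
  Ψ-+ (suc m) n x = begin
    x ^ (m ℕ.+ n) + Ψ (m ℕ.+ n) x            ≡⟨ cong₂ _+_ (^-distribˡ-+-* x m n) (Ψ-+ m n x) ⟩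
    x ^ m * x ^ n + (x ^ n * Ψ m x + Ψ n x)  ≡⟨ regroup (x ^ m) (x ^ n) (Ψ m x) (Ψ n x) ⟩
    x ^ n * (x ^ m + Ψ m x) + Ψ n x          ∎
    where
    regroup : ∀ a c s t → a * c + (c * s + t) ≡ c * (a + s) + t
    regroup = solve-∀

  Ψ-* : ∀ m n x → Ψ (m ℕ.* n) x ≡ Ψ n x * Ψ m (x ^ n)
  Ψ-* zero    n x = sym (*-zeroʳ (Ψ n x))
  Ψ-* (suc m) n x = begin
    Ψ (n ℕ.+ m ℕ.* n) x                          ≡⟨ Ψ-+ n (m ℕ.* n) x ⟩
    x ^ (m ℕ.* n) * Ψ n x + Ψ (m ℕ.* n) x        ≡⟨ cong₂ (λ a s → a * Ψ n x + s) x^[mn]≡[x^n]^m (Ψ-* m n x) ⟩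
    (x ^ n) ^ m * Ψ n x + Ψ n x * Ψ m (x ^ n)    ≡⟨ factor ((x ^ n) ^ m) (Ψ n x) (Ψ m (x ^ n)) ⟩
    Ψ n x * ((x ^ n) ^ m + Ψ m (x ^ n))          ∎
    where
    x^[mn]≡[x^n]^m : x ^ (m ℕ.* n) ≡ (x ^ n) ^ m
    x^[mn]≡[x^n]^m = trans (cong (x ^_) (ℕ.*-comm m n)) (sym (^-*-assoc x n m))
    factor : ∀ a s t → a * s + s * t ≡ s * (a + t)
    factor = solve-∀

  Ψ-geometric : ∀ n x → x ^ n - 1ℤ ≡ (x - 1ℤ) * Ψ n x
  Ψ-geometric zero    x = sym (*-zeroʳ (x - 1ℤ))
  Ψ-geometric (suc n) x = begin
    x * x ^ n - 1ℤ                           ≡⟨ split x (x ^ n) ⟩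
    (x - 1ℤ) * x ^ n + (x ^ n - 1ℤ)          ≡⟨ cong (λ s → (x - 1ℤ) * x ^ n + s) (Ψ-geometric n x) ⟩
    (x - 1ℤ) * x ^ n + (x - 1ℤ) * Ψ n x      ≡⟨ sym (*-distribˡ-+ (x - 1ℤ) (x ^ n) (Ψ n x)) ⟩
    (x - 1ℤ) * (x ^ n + Ψ n x)               ∎
    where
    split : ∀ a c → a * c - 1ℤ ≡ (a - 1ℤ) * c + (c - 1ℤ)
    split = solve-∀

  ∣x-1⇒∣x^n-1 : ∀ {d x} n → d ∣ x - 1ℤ → d ∣ x ^ n - 1ℤ
  ∣x-1⇒∣x^n-1 {d} {x} n d∣x-1 = subst (d ∣_) (sym (Ψ-geometric n x)) (∣m⇒∣m*n (Ψ n x) d∣x-1)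

  ∣x-1⇒∣Ψ-n : ∀ {d x} n → d ∣ x - 1ℤ → d ∣ Ψ n x - + n
  ∣x-1⇒∣Ψ-n         zero    _     = divides 0ℤ refl
  ∣x-1⇒∣Ψ-n {d} {x} (suc n) d∣x-1 =
    subst (d ∣_) (sym Ψ[1+n]-[1+n]) (∣m∣n⇒∣m+n (∣x-1⇒∣x^n-1 n d∣x-1) (∣x-1⇒∣Ψ-n n d∣x-1))
    where
    regroup : ∀ a s m → (a + s) - (1ℤ + m) ≡ (a - 1ℤ) + (s - m)
    regroup = solve-∀
    Ψ[1+n]-[1+n] : Ψ (suc n) x - + suc n ≡ (x ^ n - 1ℤ) + (Ψ n x - + n)
    Ψ[1+n]-[1+n] = trans (cong (Ψ (suc n) x -_) (pos-+ 1 n)) (regroup (x ^ n) (Ψ n x) (+ n))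

  ∣x-1∧∣n⇒∣Ψ : ∀ {d x} n → d ∣ x - 1ℤ → d ∣ + n → d ∣ Ψ n x
  ∣x-1∧∣n⇒∣Ψ {d} {x} n d∣x-1 d∣n =
    subst (d ∣_) (cancel (Ψ n x) (+ n)) (∣m∣n⇒∣m+n (∣x-1⇒∣Ψ-n n d∣x-1) d∣n)
    where
    cancel : ∀ s m → s - m + m ≡ s
    cancel = solve-∀

  *-pres-∣ : ∀ {a b c e} → a ∣ b → c ∣ e → a * c ∣ b * e
  *-pres-∣ {b = b} {c = c} a∣b c∣e = ∣-trans (*-monoˡ-∣ c a∣b) (*-monoʳ-∣ b c∣e)

  ∣x-1⇒p^h∣Ψ[p^h] : ∀ {p x} h → + p ∣ x - 1ℤ → + (p ℕ.^ h) ∣ Ψ (p ℕ.^ h) x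
  ∣x-1⇒p^h∣Ψ[p^h]         zero    _     = ∣ᵤ⇒∣ (ℕ.1∣ _)
  ∣x-1⇒p^h∣Ψ[p^h] {p} {x} (suc h) p∣x-1 =
    subst₂ _∣_ (sym +[p*p^h]) (sym (Ψ-* p (p ℕ.^ h) x))
      (*-pres-∣ (∣x-1⇒p^h∣Ψ[p^h] h p∣x-1)
                (∣x-1∧∣n⇒∣Ψ p (∣x-1⇒∣x^n-1 (p ℕ.^ h) p∣x-1) ∣-refl))
    where
    +[p*p^h] : + (p ℕ.* p ℕ.^ h) ≡ + (p ℕ.^ h) * + p
    +[p*p^h] = trans (pos-* p (p ℕ.^ h)) (*-comm (+ p) (+ (p ℕ.^ h)))

  p^h∣Ψ[p^h] : ∀ {p x} h → Prime p → + (p ℕ.^ h) ∣ x ^ (p ℕ.^ h) - 1ℤ →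
               + (p ℕ.^ h) ∣ Ψ (p ℕ.^ h) x
  p^h∣Ψ[p^h] {p} {x} h p-prime p^h∣x^p^h-1 with + p ∣? x - 1ℤ
  ... | yes p∣x-1 = ∣x-1⇒p^h∣Ψ[p^h] h p∣x-1
  ... | no  p∤x-1 = ∣ᵤ⇒∣ (ℤ.coprime-divisor (+ (p ℕ.^ h)) (x - 1ℤ) (Ψ (p ℕ.^ h) x)
                            p^h⊥x-1 (∣⇒∣ᵤ p^h∣[x-1]Ψ))
    where
    p^h⊥x-1 : ℤ.Coprime (+ (p ℕ.^ h)) (x - 1ℤ)
    p^h⊥x-1 = coprime-^ˡ h (prime∤⇒coprime p-prime (λ p∣ → p∤x-1 (∣ᵤ⇒∣ p∣)))
    p^h∣[x-1]Ψ : + (p ℕ.^ h) ∣ (x - 1ℤ) * Ψ (p ℕ.^ h) x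
    p^h∣[x-1]Ψ = subst (_ ∣_) (Ψ-geometric (p ℕ.^ h) x) p^h∣x^p^h-1

  p^t∣Ψ : ∀ {p t h b x} → Prime p → h ℕ.≤ t → p ℕ.^ t ℕ.∣ b →
          + (p ℕ.^ t) ∣ x ^ (p ℕ.^ h) - 1ℤ → + (p ℕ.^ t) ∣ Ψ b x
  p^t∣Ψ {p} {t} {h} {b} {x} p-prime h≤t (ℕ.divides c b≡c*p^t) p^t∣x^m-1 =
    subst₂ _∣_ (sym +p^t≡+m*+p^a) (sym Ψb≡ΨmΨk)
      (*-pres-∣ (p^h∣Ψ[p^h] h p-prime (∣-trans m∣p^t p^t∣x^m-1))
                (∣x-1∧∣n⇒∣Ψ k (∣-trans p^a∣p^t p^t∣x^m-1) (∣ᵤ⇒∣ (ℕ.n∣m*n c))))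
    where
    m p^a k : ℕ
    m   = p ℕ.^ h
    p^a = p ℕ.^ (t ℕ.∸ h)
    k   = c ℕ.* p^a
    p^t≡m*p^a : p ℕ.^ t ≡ m ℕ.* p^a
    p^t≡m*p^a = begin
      p ℕ.^ t                    ≡⟨ cong (p ℕ.^_) (sym (ℕ.m∸n+n≡m h≤t)) ⟩
      p ℕ.^ (t ℕ.∸ h ℕ.+ h)      ≡⟨ ℕ.^-distribˡ-+-* p (t ℕ.∸ h) h ⟩
      p^a ℕ.* m                  ≡⟨ ℕ.*-comm p^a m ⟩
      m ℕ.* p^a                  ∎
    m∣p^t : + m ∣ + (p ℕ.^ t)
    m∣p^t = ∣ᵤ⇒∣ (subst (m ℕ.∣_) (sym p^t≡m*p^a) (ℕ.m∣m*n p^a))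
    p^a∣p^t : + p^a ∣ + (p ℕ.^ t)
    p^a∣p^t = ∣ᵤ⇒∣ (subst (p^a ℕ.∣_) (sym p^t≡m*p^a) (ℕ.n∣m*n m))
    +p^t≡+m*+p^a : + (p ℕ.^ t) ≡ + m * + p^a
    +p^t≡+m*+p^a = trans (cong +_ p^t≡m*p^a) (pos-* m p^a)
    Ψb≡ΨmΨk : Ψ b x ≡ Ψ m x * Ψ k (x ^ m)
    Ψb≡ΨmΨk = begin
      Ψ b x                      ≡⟨ cong (λ n → Ψ n x) b≡c*p^t ⟩
      Ψ (c ℕ.* p ℕ.^ t) x        ≡⟨ cong (λ n → Ψ (c ℕ.* n) x) (trans p^t≡m*p^a (ℕ.*-comm m p^a)) ⟩
      Ψ (c ℕ.* (p^a ℕ.* m)) x    ≡⟨ cong (λ n → Ψ n x) (sym (ℕ.*-assoc c p^a m)) ⟩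
      Ψ (k ℕ.* m) x              ≡⟨ Ψ-* k m x ⟩
      Ψ m x * Ψ k (x ^ m)        ∎

open import Defs
open import Data.Nat using (ℕ; _^_; _<_; _≤_; _∸_)
open import Data.Fin using (Fin)
import Data.Fin
open import Data.Integer using (ℤ; +_; ∣_∣)
open import Data.Integer.Divisibility using (_∣_)
open import Data.Integer.Divisibility.Signed using (∣⇒∣ᵤ; ∣ᵤ⇒∣)
open import Data.Nat.Primality using (Prime; prime⇒nonZero)
open import Data.Nat.Coprimality using (Coprime; prime⇒coprime)
import Data.Nat.Coprimality as Coprimality
open import Data.Nat.Properties using (≤-trans; m∸n≤m)
import Data.Nat.Divisibility as ℕ
open import Data.Product using (proj₁; proj₂)
open import Relation.Binary.PropositionalEquality using (_≡_; sym; subst)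
open CoprimeFactors
open Repunit

lemma5p3 : (ℓ : ℕ) (r t h : Fin ℓ → ℕ) (b : ℕ) (x : ℤ) →
    (∀ i → Prime (r i)) →
    (∀ i j → i Data.Fin.< j → r i < r j) →
    (∀ i → 1 ≤ t i) →
    b ≡ ∏ ℓ (λ i → r i ^ t i) →
    Coprime ∣ x ∣ b →
    (∀ i → h i ≤ t i ∸ 1) →
    (∀ i → IsOrd (r i ^ t i) x (r i ^ h i)) →
    + b ∣ Ψ b x
lemma5p3 ℓ r t h b x prime increasing _ b≡∏ _ h≤t-1 ord =
  subst (ℕ._∣ ∣ Ψ b x ∣) (sym b≡∏)
    (pairwiseCoprime∧∣⇒∏∣ ℓ (λ i → r i ^ t i) r^t-pairwiseCoprime r^t∣Ψ)
  where
  r^t-pairwiseCoprime : ∀ i j → i Data.Fin.< j → Coprime (r i ^ t i) (r j ^ t j)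
  r^t-pairwiseCoprime i j i<j =
    coprime-^ (t i) (t j)
      (Coprimality.sym (prime⇒coprime (prime j) {{prime⇒nonZero (prime i)}} (increasing i j i<j)))
  r^t∣Ψ : ∀ i → + (r i ^ t i) ∣ Ψ b x
  r^t∣Ψ i = ∣⇒∣ᵤ (p^t∣Ψ (prime i) (≤-trans (h≤t-1 i) (m∸n≤m (t i) 1)) r^t∣b
                        (∣ᵤ⇒∣ (proj₁ (proj₂ (ord i)))))
    where
    r^t∣b : r i ^ t i ℕ.∣ b
    r^t∣b = subst (r i ^ t i ℕ.∣_) (sym b≡∏) (∣∏ ℓ (λ j → r j ^ t j) i)
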